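{- Let $m\ge4$ and let $A$ be an independent set of vertices in $H_m$. Then \[ \sum_{i\in\mathbb{Z}_m}\varepsilon_i(A)+\sum_{i\in\mathbb{Z}_m}\sum_{x\in\mathbb{Z}_2^2}|A_2(i,x)|\le 2m+\sum_{i\in\mathbb{Z}_m}\chi[A_1(i)\ne\emptyset]. \]
   Context: For $m\ge4$, $H_m$ is the $4$-graph with vertex set $\mathbb{Z}_m\times\mathbb{Z}_2^2\times\mathbb{Z}_2^2\times\mathbb{Z}_2^2$, vertices written $(i,x,y,z)$, in which four distinct vertices form an edge iff they can be labeled $v_1,v_2,v_3,v_4$ so that one of the following holds (indices $i$ in $\mathbb{Z}_m$): (1) $v_t=(i,x,y,z_t)$ for $t=1,2,3,4$; (2) $v_t=(i,x_t,y_t,z_t)$ for $t=1,\dots,4$, with $x_1+x_2+x_3+x_4=0$ and $(x_k,y_k)\ne(x_l,y_l)$ for $k\ne l$; (3) $v_1=(i,x_1,y_1',z_1')$, $v_2=(i,x_1,y_1'',z_1'')$, $v_3=(i+1,x_2',y_2',z_2')$, $v_4=(i+1,x_2'',y_2'',z_2'')$ with $y_1'\ne y_1''$ and $y_1'+y_1''+x_2'+x_2''=0$; (4) $v_1=(i,x_1,y_1,z_1')$, $v_2=(i,x_1,y_1,z_1'')$ with $z_1'\ne z_1''$, and either (a) $v_3=(i,x_2,y_2,z_2')$, $v_4=(i,x_2,y_2,z_2'')$ with $(x_1,y_1)\ne(x_2,y_2)$ and $z_2'\ne z_2''$; or (b) $v_3=(i+2,x_2,y_2',z_2')$, $v_4=(i+2,x_2,y_2'',z_2'')$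 with $y_2'\ne y_2''$; or (c) $v_3=(i+3,x_2',y_2',z_2')$, $v_4=(i+3,x_2'',y_2'',z_2'')$ with $z_1'+z_1''+x_2'+x_2''=0$. A vertex set is independent if it contains no edge. For a vertex set $A$: $A_1(i)=\{x:\exists y,z,\ (i,x,y,z)\in A\}$, $A_2(i,x)=\{y:\exists z,\ (i,x,y,z)\in A\}$, $A_3(i,x,y)=\{z:(i,x,y,z)\in A\}$, and $\varepsilon_i(A)=\sum_{x,y\in\mathbb{Z}_2^2}\max\{0,|A_3(i,x,y)|-1\}$. $\chi[B]$ is $1$ if condition $B$ holds and $0$ otherwise. -}

module Defs where

open import Data.Bool using (Bool; true; false; _xor_; _∨_; if_then_else_)
open import Data.Nat using (ℕ; zero; suc; _+_; _∸_)
open import Data.Nat.DivMod using (_mod_)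
open import Data.Fin using (Fin; toℕ)
open import Data.List using (List; []; _∷_; map; allFin)
open import Data.Nat.ListAction using (sum)
open import Data.Bool.ListAction using (any)
open import Data.Product using (_×_; _,_; proj₁; proj₂)
open import Data.Sum using (_⊎_)
open import Relation.Binary.PropositionalEquality using (_≡_; _≢_)
open import Relation.Nullary using (¬_)

-- Z₂ as Bool with xor; Z₂² as pairs
Z22 : Set
Z22 = Bool × Bool

_⊕_ : Z22 → Z22 → Z22
(a , b) ⊕ (c , d) = (a xor c , b xor d)
infixl 6 _⊕_

0² : Z22
0² = (false , false)

allZ22 : List Z22
allZ22 = (false , false) ∷ (false , true) ∷ (true , false) ∷ (true , true) ∷ []

Vertex : ℕ → Set
Vertex m = Fin m × Z22 × Z22 × Z22

module _ {m : ℕ} where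
  idx : Vertex m → Fin m
  idx (i , _ , _ , _) = i
  xc yc zc : Vertex m → Z22
  xc (_ , x , _ , _) = x
  yc (_ , _ , y , _) = y
  zc (_ , _ , _ , z) = z
  xy : Vertex m → Z22 × Z22
  xy (_ , x , y , _) = (x , y)

shift : (m : ℕ) → Fin m → ℕ → Fin m
shift (suc n) i k = (toℕ i + k) mod suc n

Cond1 : (m : ℕ) → (v1 v2 v3 v4 : Vertex m) → Set
Cond1 m v1 v2 v3 v4 =
  (idx v2 ≡ idx v1 × idx v3 ≡ idx v1 × idx v4 ≡ idx v1) ×
  (xc v2 ≡ xc v1 × xc v3 ≡ xc v1 × xc v4 ≡ xc v1) ×
  (yc v2 ≡ yc v1 × yc v3 ≡ yc v1 × yc v4 ≡ yc v1)

Cond2 : (m : ℕ) → (v1 v2 v3 v4 : Vertex m) → Set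
Cond2 m v1 v2 v3 v4 =
  (idx v2 ≡ idx v1 × idx v3 ≡ idx v1 × idx v4 ≡ idx v1) ×
  (xc v1 ⊕ xc v2 ⊕ xc v3 ⊕ xc v4 ≡ 0²) ×
  (xy v1 ≢ xy v2 × xy v1 ≢ xy v3 × xy v1 ≢ xy v4 ×
   xy v2 ≢ xy v3 × xy v2 ≢ xy v4 × xy v3 ≢ xy v4)

Cond3 : (m : ℕ) → (v1 v2 v3 v4 : Vertex m) → Set
Cond3 m v1 v2 v3 v4 =
  idx v2 ≡ idx v1 × xc v2 ≡ xc v1 ×
  idx v3 ≡ shift m (idx v1) 1 × idx v4 ≡ shift m (idx v1) 1 ×
  yc v1 ≢ yc v2 ×
  (yc v1 ⊕ yc v2 ⊕ xc v3 ⊕ xc v4 ≡ 0²)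

Cond4a Cond4b Cond4c : (m : ℕ) → (v1 v2 v3 v4 : Vertex m) → Set
Cond4a m v1 v2 v3 v4 =
  idx v3 ≡ idx v1 × idx v4 ≡ idx v1 × xy v4 ≡ xy v3 ×
  xy v1 ≢ xy v3 × zc v3 ≢ zc v4
Cond4b m v1 v2 v3 v4 =
  idx v3 ≡ shift m (idx v1) 2 × idx v4 ≡ shift m (idx v1) 2 ×
  xc v4 ≡ xc v3 × yc v3 ≢ yc v4
Cond4c m v1 v2 v3 v4 =
  idx v3 ≡ shift m (idx v1) 3 × idx v4 ≡ shift m (idx v1) 3 ×
  (zc v1 ⊕ zc v2 ⊕ xc v3 ⊕ xc v4 ≡ 0²)

Cond4 : (m : ℕ) → (v1 v2 v3 v4 : Vertex m) → Set
Cond4 m v1 v2 v3 v4 =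
  (idx v2 ≡ idx v1 × xy v2 ≡ xy v1 × zc v1 ≢ zc v2) ×
  (Cond4a m v1 v2 v3 v4 ⊎ Cond4b m v1 v2 v3 v4 ⊎ Cond4c m v1 v2 v3 v4)

LabeledEdge : (m : ℕ) → (v1 v2 v3 v4 : Vertex m) → Set
LabeledEdge m v1 v2 v3 v4 =
  Cond1 m v1 v2 v3 v4 ⊎ Cond2 m v1 v2 v3 v4 ⊎ Cond3 m v1 v2 v3 v4 ⊎ Cond4 m v1 v2 v3 v4

VSet : ℕ → Set
VSet m = Vertex m → Bool

-- independent: no four distinct vertices of A form an edge
-- (quantifying over all orderings covers "can be labeled")
Independent : (m : ℕ) → VSet m → Set
Independent m A = ∀ (v1 v2 v3 v4 : Vertex m) →
  A v1 ≡ true → A v2 ≡ true → A v3 ≡ true → A v4 ≡ true →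
  v1 ≢ v2 → v1 ≢ v3 → v1 ≢ v4 → v2 ≢ v3 → v2 ≢ v4 → v3 ≢ v4 →
  ¬ LabeledEdge m v1 v2 v3 v4

count : {X : Set} → (X → Bool) → List X → ℕ
count p [] = 0
count p (x ∷ xs) = (if p x then 1 else 0) + count p xs

A3size : {m : ℕ} → VSet m → Fin m → Z22 → Z22 → ℕ
A3size A i x y = count (λ z → A (i , x , y , z)) allZ22

A2size : {m : ℕ} → VSet m → Fin m → Z22 → ℕ
A2size A i x = count (λ y → any (λ z → A (i , x , y , z)) allZ22) allZ22

chiA1 : {m : ℕ} → VSet m → Fin m → ℕ
chiA1 A i = if any (λ x → any (λ y → any (λ z → A (i , x , y , z)) allZ22) allZ22) allZ22
            then 1 else 0

eps : {m : ℕ} → VSet m → Fin m → ℕ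
eps A i = sum (map (λ x → sum (map (λ y → A3size A i x y ∸ 1) allZ22)) allZ22)

sumZm : (m : ℕ) → (Fin m → ℕ) → ℕ
sumZm m f = sum (map f (allFin m))

-- Put ε₂_i(A) = Σ_x max{0, |A_2(i,x)| − 1} and K_i = |A_1(i)|, so Σ_x |A_2(i,x)| = ε₂_i(A) + K_i.
-- For every j ∈ Z_m, independence of A yields the local inequality
--   ε_j(A) + ε₂_{j+2}(A) + K_{j+3} ≤ 2 + χ[A_1(j+3) ≠ ∅],
-- and summing it over j gives the theorem, since shifting by 2 or 3 permutes Z_m.
-- Locally, edges of types (4a), (2) and (4b) leave at most one nonzero summand in
-- ε_j(A) + ε₂_{j+2}(A). It has the form |Z| − 1, where by edges of type (4c) or (3) the
-- nonzero differences of Z ⊆ Z_2^2 avoid those of X = A_1(j+3), and by edges of types (1)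
-- and (2) neither Z nor X is all of Z_2^2; such pairs satisfy |Z| − 1 + |X| ≤ 2 + χ[X ≠ ∅].
module Submission where

open import Defs
open import Data.Nat using (ℕ; _+_; _*_; _≤_)
open import Data.List using (map)
open import Data.Nat.ListAction using (sum)

open import Data.Bool using (Bool; true; false; if_then_else_)
open import Data.Bool.Properties using () renaming (_≟_ to _≟ᵇ_)
open import Data.Bool.ListAction using (any)
open import Data.Empty using (⊥; ⊥-elim)
open import Data.Fin using (Fin; toℕ; fromℕ; inject₁) renaming (zero to fzero; suc to fsuc)
open import Data.Fin.Properties using (toℕ-fromℕ<; toℕ-injective; toℕ-inject₁; toℕ-fromℕ; toℕ<n)
open import Data.List using ([]; _∷_; allFin; tabulate)
open import Data.List.Properties using (map-tabulate; map-cong; tabulate-cong)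
open import Data.List.Relation.Unary.All as All using (All; []; _∷_)
open import Data.List.Relation.Unary.Any using (Any; here; there)
open import Data.List.Relation.Unary.AllPairs using ([]; _∷_)
open import Data.List.Relation.Unary.Unique.Propositional using (Unique)
open import Data.Nat using (zero; suc; _∸_; _<_; z≤n; s≤s; _≤?_; _/_; _%_) renaming (_≟_ to _≟ℕ_)
open import Data.Nat.DivMod using (m≡m%n+[m/n]*n; %-distribˡ-+; m%n%n≡m%n; m<n⇒m%n≡m; n%n≡0)
open import Data.Nat.Properties
open import Algebra.Properties.CommutativeSemigroup +-commutativeSemigroup using (interchange)
open import Data.Product using (∃; ∃₂; _×_; _,_; proj₁; proj₂)
open import Data.Product.Properties using (≡-dec)
open import Data.Sum using (inj₁; inj₂)
open import Function using (_∘_; id; case_of_)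
open import Relation.Binary.PropositionalEquality
open import Relation.Nullary using (Dec; yes; no; ¬_; ¬?)
open import Relation.Nullary.Decidable using (map′; _×-dec_; _→-dec_; from-yes; decidable-stable)

_≟₂₂_ : (u v : Z22) → Dec (u ≡ v)
_≟₂₂_ = ≡-dec _≟ᵇ_ _≟ᵇ_

∀-Bool? : {P : Bool → Set} → (∀ b → Dec (P b)) → Dec (∀ b → P b)
∀-Bool? P? = map′ (λ { (f , t) false → f ; (f , t) true → t }) (λ h → h false , h true)
  (P? false ×-dec P? true)

∀-Z22? : {P : Z22 → Set} → (∀ z → Dec (P z)) → Dec (∀ z → P z)
∀-Z22? P? = map′ (λ h (a , b) → h a b) (λ h a b → h (a , b)) (∀-Bool? λ a → ∀-Bool? λ b → P? (a , b))

x⊕x⊕y⊕y≡0² : ∀ x y → x ⊕ x ⊕ y ⊕ y ≡ 0²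
x⊕x⊕y⊕y≡0² = from-yes (∀-Z22? λ x → ∀-Z22? λ y → (x ⊕ x ⊕ y ⊕ y) ≟₂₂ 0²)

⊕≡0²⇒≢ : ∀ z₁ z₂ x₁ x₂ → z₁ ⊕ z₂ ⊕ x₁ ⊕ x₂ ≡ 0² → z₁ ≢ z₂ → x₁ ≢ x₂
⊕≡0²⇒≢ = from-yes (∀-Z22? λ z₁ → ∀-Z22? λ z₂ → ∀-Z22? λ x₁ → ∀-Z22? λ x₂ →
  ((z₁ ⊕ z₂ ⊕ x₁ ⊕ x₂) ≟₂₂ 0²) →-dec ¬? (z₁ ≟₂₂ z₂) →-dec ¬? (x₁ ≟₂₂ x₂))

allZ22-unique : Unique allZ22
allZ22-unique = ((λ ()) ∷ (λ ()) ∷ (λ ()) ∷ []) ∷ ((λ ()) ∷ (λ ()) ∷ []) ∷ ((λ ()) ∷ []) ∷ [] ∷ []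

Full : (Z22 → Bool) → Set
Full p = ∀ z → p z ≡ true

DisjointDifferences : (Z22 → Bool) → (Z22 → Bool) → Set
DisjointDifferences Zs Xs = ∀ z₁ z₂ x₁ x₂ → Zs z₁ ≡ true → Zs z₂ ≡ true → Xs x₁ ≡ true → Xs x₂ ≡ true →
  z₁ ≢ z₂ → z₁ ⊕ z₂ ⊕ x₁ ⊕ x₂ ≢ 0²

χ : Bool → ℕ
χ b = if b then 1 else 0

excess : (Z22 → Bool) → ℕ
excess p = count p allZ22 ∸ 1

ExcessBound : (Z22 → Bool) → (Z22 → Bool) → Set
ExcessBound Zs Xs = ¬ Full Zs → ¬ Full Xs → DisjointDifferences Zs Xs →
  excess Zs + count Xs allZ22 ≤ 2 + χ (any Xs allZ22)

excessBound? : ∀ Zs Xs → Dec (ExcessBound Zs Xs)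
excessBound? Zs Xs = ¬? (full? Zs) →-dec ¬? (full? Xs) →-dec disjoint? →-dec (_ ≤? _)
  where
    full? : ∀ p → Dec (Full p)
    full? p = ∀-Z22? λ z → p z ≟ᵇ true
    disjoint? : Dec (DisjointDifferences Zs Xs)
    disjoint? = ∀-Z22? λ z₁ → ∀-Z22? λ z₂ → ∀-Z22? λ x₁ → ∀-Z22? λ x₂ →
      (Zs z₁ ≟ᵇ true) →-dec (Zs z₂ ≟ᵇ true) →-dec (Xs x₁ ≟ᵇ true) →-dec (Xs x₂ ≟ᵇ true) →-dec
      ¬? (z₁ ≟₂₂ z₂) →-dec ¬? ((z₁ ⊕ z₂ ⊕ x₁ ⊕ x₂) ≟₂₂ 0²)

table : Bool → Bool → Bool → Bool → Z22 → Bool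
table b₀₀ _ _ _ (false , false) = b₀₀
table _ b₀₁ _ _ (false , true) = b₀₁
table _ _ b₁₀ _ (true , false) = b₁₀
table _ _ _ b₁₁ (true , true) = b₁₁

tableOf : (Z22 → Bool) → Z22 → Bool
tableOf p = table (p (false , false)) (p (false , true)) (p (true , false)) (p (true , true))

tableOf-correct : ∀ p z → tableOf p z ≡ p z
tableOf-correct p (false , false) = refl
tableOf-correct p (false , true) = refl
tableOf-correct p (true , false) = refl
tableOf-correct p (true , true) = refl

-- z ⊕ x is injective on Zs × Xs, hence |Zs| |Xs| ≤ 4; the bound is checked over all pairs.
excessBound-table : ∀ a b c d a′ b′ c′ d′ → ExcessBound (table a b c d) (table a′ b′ c′ d′)
excessBound-table = from-yes (∀-Bool? λ a → ∀-Bool? λ b → ∀-Bool? λ c → ∀-Bool? λ d →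
  ∀-Bool? λ a′ → ∀-Bool? λ b′ → ∀-Bool? λ c′ → ∀-Bool? λ d′ →
  excessBound? (table a b c d) (table a′ b′ c′ d′))

-- count, excess and any evaluate a predicate only at the four elements of Z₂²,
-- so on p and tableOf p they agree definitionally.
excess+count≤2+χ : ∀ Zs Xs → ExcessBound Zs Xs
excess+count≤2+χ Zs Xs ¬full-Zs ¬full-Xs disjoint =
  excessBound-table _ _ _ _ _ _ _ _ (¬full-Zs ∘ untable Zs) (¬full-Xs ∘ untable Xs)
    λ z₁ z₂ x₁ x₂ a₁ a₂ b₁ b₂ → disjoint z₁ z₂ x₁ x₂
      (back Zs z₁ a₁) (back Zs z₂ a₂) (back Xs x₁ b₁) (back Xs x₂ b₂)
  where
    back : ∀ p z → tableOf p z ≡ true → p z ≡ true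
    back p z = trans (sym (tableOf-correct p z))
    untable : ∀ p → Full (tableOf p) → Full p
    untable p full z = back p z (full z)

module _ {X : Set} (p : X → Bool) where

  any⇒∃ : ∀ xs → any p xs ≡ true → ∃ λ x → p x ≡ true
  any⇒∃ (x ∷ xs) h with p x in px
  ... | true = x , px
  ... | false = any⇒∃ xs h

  count≢0⇒Any : ∀ xs → count p xs ≢ 0 → Any (λ x → p x ≡ true) xs
  count≢0⇒Any [] h = ⊥-elim (h refl)
  count≢0⇒Any (x ∷ xs) h with p x in px
  ... | true = here px
  ... | false = there (count≢0⇒Any xs h)

  count≡count∸1+χ : ∀ xs → count p xs ≡ count p xs ∸ 1 + χ (any p xs)
  count≡count∸1+χ [] = refl
  count≡count∸1+χ (x ∷ xs) with p x
  ... | true = +-comm 1 (count p xs)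
  ... | false = count≡count∸1+χ xs

  count∸1≢0⇒distinct : ∀ {xs} → Unique xs → count p xs ∸ 1 ≢ 0 →
    ∃₂ λ a b → a ≢ b × p a ≡ true × p b ≡ true
  count∸1≢0⇒distinct {[]} [] h = ⊥-elim (h refl)
  count∸1≢0⇒distinct {x ∷ xs} (x∉xs ∷ unique) h with p x in px
  ... | true = let (x≢b , pb) = All.lookupAny x∉xs (count≢0⇒Any xs h) in _ , _ , x≢b , px , pb
  ... | false = count∸1≢0⇒distinct unique h

module _ {X : Set} where

  sum-map-+ : ∀ (f g : X → ℕ) xs → sum (map (λ x → f x + g x) xs) ≡ sum (map f xs) + sum (map g xs)
  sum-map-+ f g [] = refl
  sum-map-+ f g (x ∷ xs) = trans (cong (f x + g x +_) (sum-map-+ f g xs)) (interchange (f x) (g x) _ _)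

  sum-map-mono : ∀ {f g : X → ℕ} xs → (∀ x → f x ≤ g x) → sum (map f xs) ≤ sum (map g xs)
  sum-map-mono [] f≤g = ≤-refl
  sum-map-mono (x ∷ xs) f≤g = +-mono-≤ (f≤g x) (sum-map-mono xs f≤g)

  sum-map≢0⇒ : ∀ (t : X → ℕ) xs → sum (map t xs) ≢ 0 → ∃ λ x → t x ≢ 0
  sum-map≢0⇒ t [] h = ⊥-elim (h refl)
  sum-map≢0⇒ t (x ∷ xs) h with t x ≟ℕ 0
  ... | no tx≢0 = x , tx≢0
  ... | yes tx≡0 = sum-map≢0⇒ t xs (λ rest≡0 → h (cong₂ _+_ tx≡0 rest≡0))

  sum-map-zero : ∀ {t : X → ℕ} {xs} → All (λ x → t x ≡ 0) xs → sum (map t xs) ≡ 0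
  sum-map-zero [] = refl
  sum-map-zero (tx≡0 ∷ rest≡0) = cong₂ _+_ tx≡0 (sum-map-zero rest≡0)

  AtMostOneNonzero : (X → ℕ) → Set
  AtMostOneNonzero t = ∀ {x y} → x ≢ y → t x ≢ 0 → t y ≢ 0 → ⊥

  sum-map-+-≤ : ∀ {t : X → ℕ} {xs K R} → Unique xs → AtMostOneNonzero t →
    (∀ x → t x + K ≤ R) → K ≤ R → sum (map t xs) + K ≤ R
  sum-map-+-≤ [] _ _ K≤R = K≤R
  sum-map-+-≤ {t} {x ∷ xs} {K} {R} (x∉xs ∷ unique) one bound K≤R with t x ≟ℕ 0
  ... | yes tx≡0 rewrite tx≡0 = sum-map-+-≤ unique one bound K≤R
  ... | no tx≢0 = begin
    t x + sum (map t xs) + K ≡⟨ cong (λ s → t x + s + K) (sum-map-zero (All.map others-zero x∉xs)) ⟩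
    t x + 0 + K              ≡⟨ cong (_+ K) (+-identityʳ (t x)) ⟩
    t x + K                  ≤⟨ bound x ⟩
    R                        ∎
    where
      open ≤-Reasoning
      others-zero : ∀ {y} → x ≢ y → t y ≡ 0
      others-zero x≢y = decidable-stable (t _ ≟ℕ 0) (one x≢y tx≢0)

sumZm-cong : ∀ {m} {f g : Fin m → ℕ} → (∀ i → f i ≡ g i) → sumZm m f ≡ sumZm m g
sumZm-cong {m} f≗g = cong sum (map-cong f≗g (allFin m))

sumZm-+ : ∀ {m} (f g : Fin m → ℕ) → sumZm m (λ i → f i + g i) ≡ sumZm m f + sumZm m g
sumZm-+ {m} f g = sum-map-+ f g (allFin m)

sumZm-mono : ∀ {m} {f g : Fin m → ℕ} → (∀ i → f i ≤ g i) → sumZm m f ≤ sumZm m g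
sumZm-mono {m} = sum-map-mono (allFin m)

sumZm≡sum-tabulate : ∀ m (f : Fin m → ℕ) → sumZm m f ≡ sum (tabulate f)
sumZm≡sum-tabulate m f = cong sum (map-tabulate id f)

sum-tabulate-const : ∀ m c → sum (tabulate {n = m} (λ _ → c)) ≡ c * m
sum-tabulate-const zero c = sym (*-zeroʳ c)
sum-tabulate-const (suc m) c = trans (cong (c +_) (sum-tabulate-const m c)) (sym (*-suc c m))

sumZm-const : ∀ m c → sumZm m (λ _ → c) ≡ c * m
sumZm-const m c = trans (sumZm≡sum-tabulate m _) (sum-tabulate-const m c)

sum-tabulate-last : ∀ n (f : Fin (suc n) → ℕ) →
  sum (tabulate f) ≡ sum (tabulate (f ∘ inject₁)) + f (fromℕ n)
sum-tabulate-last zero f = +-comm (f fzero) 0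
sum-tabulate-last (suc n) f =
  trans (cong (f fzero +_) (sum-tabulate-last n (f ∘ fsuc))) (sym (+-assoc (f fzero) _ _))

module _ {n : ℕ} where

  private
    d : ℕ
    d = suc n

  toℕ-shift : ∀ (i : Fin d) k → toℕ (shift d i k) ≡ (toℕ i + k) % d
  toℕ-shift i k = toℕ-fromℕ< _

  shift-zero : ∀ (i : Fin d) → shift d i 0 ≡ i
  shift-zero i = toℕ-injective (begin
    toℕ (shift d i 0) ≡⟨ toℕ-shift i 0 ⟩
    (toℕ i + 0) % d   ≡⟨ cong (_% d) (+-identityʳ (toℕ i)) ⟩
    toℕ i % d         ≡⟨ m<n⇒m%n≡m (toℕ<n i) ⟩
    toℕ i             ∎)
    where open ≡-Reasoning

  shift-suc : ∀ (i : Fin d) k → shift d (shift d i k) 1 ≡ shift d i (suc k)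
  shift-suc i k = toℕ-injective (begin
    toℕ (shift d (shift d i k) 1) ≡⟨ toℕ-shift (shift d i k) 1 ⟩
    (toℕ (shift d i k) + 1) % d   ≡⟨ cong (λ t → (t + 1) % d) (toℕ-shift i k) ⟩
    (a % d + 1) % d               ≡⟨ %-distribˡ-+ (a % d) 1 d ⟩
    (a % d % d + 1 % d) % d       ≡⟨ cong (λ t → (t + 1 % d) % d) (m%n%n≡m%n a d) ⟩
    (a % d + 1 % d) % d           ≡⟨ %-distribˡ-+ a 1 d ⟨
    (a + 1) % d                   ≡⟨ cong (_% d) (trans (+-assoc (toℕ i) k 1) (cong (toℕ i +_) (+-comm k 1))) ⟩
    (toℕ i + suc k) % d           ≡⟨ toℕ-shift i (suc k) ⟨
    toℕ (shift d i (suc k))       ∎)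
    where
      open ≡-Reasoning
      a : ℕ
      a = toℕ i + k

  shift₁-inject₁ : ∀ (i : Fin n) → shift d (inject₁ i) 1 ≡ fsuc i
  shift₁-inject₁ i = toℕ-injective (begin
    toℕ (shift d (inject₁ i) 1) ≡⟨ toℕ-shift (inject₁ i) 1 ⟩
    (toℕ (inject₁ i) + 1) % d   ≡⟨ cong (λ t → (t + 1) % d) (toℕ-inject₁ i) ⟩
    (toℕ i + 1) % d             ≡⟨ cong (_% d) (+-comm (toℕ i) 1) ⟩
    suc (toℕ i) % d             ≡⟨ m<n⇒m%n≡m (s≤s (toℕ<n i)) ⟩
    suc (toℕ i)                 ∎)
    where open ≡-Reasoning

  shift₁-fromℕ : shift d (fromℕ n) 1 ≡ fzero
  shift₁-fromℕ = toℕ-injective (begin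
    toℕ (shift d (fromℕ n) 1) ≡⟨ toℕ-shift (fromℕ n) 1 ⟩
    (toℕ (fromℕ n) + 1) % d   ≡⟨ cong (λ t → (t + 1) % d) (toℕ-fromℕ n) ⟩
    (n + 1) % d               ≡⟨ cong (_% d) (+-comm n 1) ⟩
    d % d                     ≡⟨ n%n≡0 d ⟩
    0                         ∎)
    where open ≡-Reasoning

  shift≢ : ∀ (i : Fin d) {k} → 0 < k → k < d → shift d i k ≢ i
  shift≢ i {k} 0<k k<d i+k≡i = k≢q*d q (+-cancelˡ-≡ (toℕ i) k (q * d) i+k≡i+q*d)
    where
      open ≡-Reasoning
      q : ℕ
      q = (toℕ i + k) / d
      i+k≡i+q*d : toℕ i + k ≡ toℕ i + q * d
      i+k≡i+q*d = begin
        toℕ i + k               ≡⟨ m≡m%n+[m/n]*n (toℕ i + k) d ⟩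
        (toℕ i + k) % d + q * d ≡⟨ cong (_+ q * d) (trans (sym (toℕ-shift i k)) (cong toℕ i+k≡i)) ⟩
        toℕ i + q * d           ∎
      k≢q*d : ∀ q → k ≢ q * d
      k≢q*d zero k≡0 = <-irrefl (sym k≡0) 0<k
      k≢q*d (suc q) k≡d+q*d = <⇒≱ k<d (subst (d ≤_) (sym k≡d+q*d) (m≤m+n d (q * d)))

  sum-tabulate-shift₁ : ∀ (h : Fin d → ℕ) → sum (tabulate (λ i → h (shift d i 1))) ≡ sum (tabulate h)
  sum-tabulate-shift₁ h = begin
    sum (tabulate (λ i → h (shift d i 1)))
      ≡⟨ sum-tabulate-last n (λ i → h (shift d i 1)) ⟩
    sum (tabulate (λ i → h (shift d (inject₁ i) 1))) + h (shift d (fromℕ n) 1)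
      ≡⟨ cong₂ _+_ (cong sum (tabulate-cong (cong h ∘ shift₁-inject₁))) (cong h shift₁-fromℕ) ⟩
    sum (tabulate (h ∘ fsuc)) + h fzero
      ≡⟨ +-comm (sum (tabulate (h ∘ fsuc))) (h fzero) ⟩
    sum (tabulate h) ∎
    where open ≡-Reasoning

  sum-tabulate-shift : ∀ k (h : Fin d → ℕ) → sum (tabulate (λ i → h (shift d i k))) ≡ sum (tabulate h)
  sum-tabulate-shift zero h = cong sum (tabulate-cong (cong h ∘ shift-zero))
  sum-tabulate-shift (suc k) h = begin
    sum (tabulate (λ i → h (shift d i (suc k))))
      ≡⟨ cong sum (tabulate-cong (λ i → cong h (shift-suc i k))) ⟨
    sum (tabulate (λ i → h (shift d (shift d i k) 1)))
      ≡⟨ sum-tabulate-shift k (λ j → h (shift d j 1)) ⟩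
    sum (tabulate (λ j → h (shift d j 1)))
      ≡⟨ sum-tabulate-shift₁ h ⟩
    sum (tabulate h) ∎
    where open ≡-Reasoning

  sumZm-shift : ∀ k (h : Fin d → ℕ) → sumZm d (λ i → h (shift d i k)) ≡ sumZm d h
  sumZm-shift k h = begin
    sumZm d (λ i → h (shift d i k)) ≡⟨ sumZm≡sum-tabulate d _ ⟩
    sum (tabulate (λ i → h (shift d i k))) ≡⟨ sum-tabulate-shift k h ⟩
    sum (tabulate h)                 ≡⟨ sumZm≡sum-tabulate d h ⟨
    sumZm d h                        ∎
    where open ≡-Reasoning

module _ {m : ℕ} (A : VSet m) where

  A₃ : Fin m → Z22 → Z22 → Z22 → Bool
  A₃ i x y z = A (i , x , y , z)

  A₂ : Fin m → Z22 → Z22 → Bool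
  A₂ i x y = any (A₃ i x y) allZ22

  A₁ : Fin m → Z22 → Bool
  A₁ i x = any (A₂ i x) allZ22

  eps-row : Fin m → Z22 → ℕ
  eps-row i x = sum (map (λ y → excess (A₃ i x y)) allZ22)

  eps₂ : Fin m → ℕ
  eps₂ i = sum (map (λ x → excess (A₂ i x)) allZ22)

  sum-A2size : ∀ i → sum (map (λ x → A2size A i x) allZ22) ≡ eps₂ i + count (A₁ i) allZ22
  sum-A2size i = trans (cong sum (map-cong (λ x → count≡count∸1+χ (A₂ i x) allZ22) allZ22))
    (sum-map-+ (λ x → excess (A₂ i x)) (χ ∘ A₁ i) allZ22)

  A₂-witness : ∀ {i x y} → A₂ i x y ≡ true → ∃ λ z → A (i , x , y , z) ≡ true
  A₂-witness = any⇒∃ _ allZ22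

  A₁-witness : ∀ {i x} → A₁ i x ≡ true → ∃₂ λ y z → A (i , x , y , z) ≡ true
  A₁-witness a with any⇒∃ _ allZ22 a
  ... | y , b = y , A₂-witness b

  A₃-pair : ∀ {i x y} → excess (A₃ i x y) ≢ 0 →
    ∃₂ λ z z′ → z ≢ z′ × A (i , x , y , z) ≡ true × A (i , x , y , z′) ≡ true
  A₃-pair = count∸1≢0⇒distinct _ allZ22-unique

  A₂-pair : ∀ {i x} → excess (A₂ i x) ≢ 0 → ∃₂ λ y y′ → y ≢ y′ ×
    ∃₂ λ z z′ → A (i , x , y , z) ≡ true × A (i , x , y′ , z′) ≡ true
  A₂-pair h with count∸1≢0⇒distinct _ allZ22-unique h
  ... | y , y′ , y≢y′ , b , b′ with A₂-witness b | A₂-witness b′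
  ... | z , a | z′ , a′ = y , y′ , y≢y′ , z , z′ , a , a′

module _ {m : ℕ} {A : VSet m} (ind : Independent m A) where

  private
    no-edge-between-pairs : ∀ {B : Set} (f : Vertex m → B) {v₁ v₂ v₃ v₄} →
      A v₁ ≡ true → A v₂ ≡ true → A v₃ ≡ true → A v₄ ≡ true → v₁ ≢ v₂ → v₃ ≢ v₄ →
      f v₁ ≡ f v₂ → f v₃ ≡ f v₄ → f v₁ ≢ f v₃ → ¬ LabeledEdge m v₁ v₂ v₃ v₄
    no-edge-between-pairs f a₁ a₂ a₃ a₄ v₁≢v₂ v₃≢v₄ f₁≡f₂ f₃≡f₄ f₁≢f₃ =
      ind _ _ _ _ a₁ a₂ a₃ a₄ v₁≢v₂
        (f₁≢f₃ ∘ cong f)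
        (λ v₁≡v₄ → f₁≢f₃ (trans (cong f v₁≡v₄) (sym f₃≡f₄)))
        (λ v₂≡v₃ → f₁≢f₃ (trans f₁≡f₂ (cong f v₂≡v₃)))
        (λ v₂≡v₄ → f₁≢f₃ (trans f₁≡f₂ (trans (cong f v₂≡v₄) (sym f₃≡f₄))))
        v₃≢v₄

  A₃-not-full : ∀ i x y → ¬ Full (A₃ A i x y)
  A₃-not-full i x y full =
    ind (i , x , y , (false , false)) (i , x , y , (false , true))
        (i , x , y , (true , false)) (i , x , y , (true , true))
        (full _) (full _) (full _) (full _) (λ ()) (λ ()) (λ ()) (λ ()) (λ ()) (λ ())
        (inj₁ ((refl , refl , refl) , (refl , refl , refl) , (refl , refl , refl)))

  A₂-not-full : ∀ i x → ¬ Full (A₂ A i x)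
  A₂-not-full i x full
    with A₂-witness A (full (false , false)) | A₂-witness A (full (false , true))
       | A₂-witness A (full (true , false)) | A₂-witness A (full (true , true))
  ... | z₀ , a₀ | z₁ , a₁ | z₂ , a₂ | z₃ , a₃ =
    ind (i , x , (false , false) , z₀) (i , x , (false , true) , z₁)
        (i , x , (true , false) , z₂) (i , x , (true , true) , z₃)
        a₀ a₁ a₂ a₃ (λ ()) (λ ()) (λ ()) (λ ()) (λ ()) (λ ())
        (inj₂ (inj₁ ((refl , refl , refl) , x⊕x⊕y⊕y≡0² x x ,
          (λ ()) , (λ ()) , (λ ()) , (λ ()) , (λ ()) , (λ ()))))

  A₁-not-full : ∀ i → ¬ Full (A₁ A i)
  A₁-not-full i full
    with A₁-witness A (full (false , false)) | A₁-witness A (full (false , true))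
       | A₁-witness A (full (true , false)) | A₁-witness A (full (true , true))
  ... | y₀ , z₀ , a₀ | y₁ , z₁ , a₁ | y₂ , z₂ , a₂ | y₃ , z₃ , a₃ =
    ind (i , (false , false) , y₀ , z₀) (i , (false , true) , y₁ , z₁)
        (i , (true , false) , y₂ , z₂) (i , (true , true) , y₃ , z₃)
        a₀ a₁ a₂ a₃ (λ ()) (λ ()) (λ ()) (λ ()) (λ ()) (λ ())
        (inj₂ (inj₁ ((refl , refl , refl) , refl ,
          (λ ()) , (λ ()) , (λ ()) , (λ ()) , (λ ()) , (λ ()))))

  excess-A₃-exclusive : ∀ i {x y x′ y′} → (x , y) ≢ (x′ , y′) →
    excess (A₃ A i x y) ≢ 0 → excess (A₃ A i x′ y′) ≢ 0 → ⊥
  excess-A₃-exclusive i xy≢x′y′ h h′ with A₃-pair A h | A₃-pair A h′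
  ... | _ , _ , z₁≢z₂ , a₁ , a₂ | _ , _ , z₃≢z₄ , a₃ , a₄ =
    no-edge-between-pairs xy a₁ a₂ a₃ a₄ (z₁≢z₂ ∘ cong zc) (z₃≢z₄ ∘ cong zc) refl refl xy≢x′y′
      (inj₂ (inj₂ (inj₂ ((refl , refl , z₁≢z₂) , inj₁ (refl , refl , refl , xy≢x′y′ , z₃≢z₄)))))

  excess-A₂-exclusive : ∀ i → AtMostOneNonzero (λ x → excess (A₂ A i x))
  excess-A₂-exclusive i {x} {x′} x≢x′ h h′ with A₂-pair A h | A₂-pair A h′
  ... | _ , _ , y₁≢y₂ , _ , _ , a₁ , a₂ | _ , _ , y₃≢y₄ , _ , _ , a₃ , a₄ =
    no-edge-between-pairs xc a₁ a₂ a₃ a₄ (y₁≢y₂ ∘ cong yc) (y₃≢y₄ ∘ cong yc) refl refl x≢x′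
      (inj₂ (inj₁ ((refl , refl , refl) , x⊕x⊕y⊕y≡0² x x′ ,
        y₁≢y₂ ∘ cong proj₂ , x≢x′ ∘ cong proj₁ , x≢x′ ∘ cong proj₁ ,
        x≢x′ ∘ cong proj₁ , x≢x′ ∘ cong proj₁ , y₃≢y₄ ∘ cong proj₂)))

  eps-eps₂-exclusive : ∀ {i} → shift m i 2 ≢ i → eps A i ≢ 0 → eps₂ A (shift m i 2) ≢ 0 → ⊥
  eps-eps₂-exclusive {i} i+2≢i h h′
    with sum-map≢0⇒ (eps-row A i) allZ22 h | sum-map≢0⇒ (λ x → excess (A₂ A (shift m i 2) x)) allZ22 h′
  ... | x , row≢0 | _ , e′ with sum-map≢0⇒ (λ y → excess (A₃ A i x y)) allZ22 row≢0
  ... | _ , e with A₃-pair A e | A₂-pair A e′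
  ... | _ , _ , z₁≢z₂ , a₁ , a₂ | _ , _ , y₃≢y₄ , _ , _ , a₃ , a₄ =
    no-edge-between-pairs idx a₁ a₂ a₃ a₄ (z₁≢z₂ ∘ cong zc) (y₃≢y₄ ∘ cong yc) refl refl (i+2≢i ∘ sym)
      (inj₂ (inj₂ (inj₂ ((refl , refl , z₁≢z₂) , inj₂ (inj₁ (refl , refl , refl , y₃≢y₄))))))

  A₃-A₁-disjoint : ∀ {i x y} → shift m i 3 ≢ i → DisjointDifferences (A₃ A i x y) (A₁ A (shift m i 3))
  A₃-A₁-disjoint i+3≢i z₁ z₂ x₁ x₂ a₁ a₂ b₁ b₂ z₁≢z₂ sum≡0 with A₁-witness A b₁ | A₁-witness A b₂
  ... | _ , _ , a₃ | _ , _ , a₄ =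
    no-edge-between-pairs idx a₁ a₂ a₃ a₄ (z₁≢z₂ ∘ cong zc) (⊕≡0²⇒≢ z₁ z₂ x₁ x₂ sum≡0 z₁≢z₂ ∘ cong xc)
      refl refl (i+3≢i ∘ sym)
      (inj₂ (inj₂ (inj₂ ((refl , refl , z₁≢z₂) , inj₂ (inj₂ (refl , refl , sum≡0))))))

  A₂-A₁-disjoint : ∀ {i x} → shift m i 1 ≢ i → DisjointDifferences (A₂ A i x) (A₁ A (shift m i 1))
  A₂-A₁-disjoint i+1≢i y₁ y₂ x₁ x₂ b₁ b₂ c₁ c₂ y₁≢y₂ sum≡0
    with A₂-witness A b₁ | A₂-witness A b₂ | A₁-witness A c₁ | A₁-witness A c₂
  ... | _ , a₁ | _ , a₂ | _ , _ , a₃ | _ , _ , a₄ =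
    no-edge-between-pairs idx a₁ a₂ a₃ a₄ (y₁≢y₂ ∘ cong yc) (⊕≡0²⇒≢ y₁ y₂ x₁ x₂ sum≡0 y₁≢y₂ ∘ cong xc)
      refl refl (i+1≢i ∘ sym)
      (inj₂ (inj₂ (inj₁ (refl , refl , refl , refl , y₁≢y₂ , sum≡0))))

module _ {n : ℕ} (3≤n : 3 ≤ n) {A : VSet (suc n)} (ind : Independent (suc n) A) where

  private
    d : ℕ
    d = suc n

    K R : Fin d → ℕ
    K j = count (A₁ A (shift d j 3)) allZ22
    R j = 2 + chiA1 A (shift d j 3)

    shift≢-small : ∀ (i : Fin d) {k} → 0 < k → k ≤ 3 → shift d i k ≢ i
    shift≢-small i 0<k k≤3 = shift≢ i 0<k (s≤s (≤-trans k≤3 3≤n))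

    excess+K≤R : ∀ j {Zs} → ¬ Full Zs → DisjointDifferences Zs (A₁ A (shift d j 3)) →
      excess Zs + K j ≤ R j
    excess+K≤R j ¬full disjoint = excess+count≤2+χ _ _ ¬full (A₁-not-full ind (shift d j 3)) disjoint

    K≤R : ∀ j → K j ≤ R j
    K≤R j = excess+K≤R j {λ _ → false} (λ full → case full 0² of λ ()) (λ _ _ _ _ ())

    eps+K≤R : ∀ j → eps A j + K j ≤ R j
    eps+K≤R j = sum-map-+-≤ allZ22-unique row-exclusive row+K≤R (K≤R j)
      where
        row-exclusive : AtMostOneNonzero (eps-row A j)
        row-exclusive {x} {x′} x≢x′ h h′
          with sum-map≢0⇒ (λ y → excess (A₃ A j x y)) allZ22 h
             | sum-map≢0⇒ (λ y → excess (A₃ A j x′ y)) allZ22 h′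
        ... | _ , e | _ , e′ = excess-A₃-exclusive ind j (x≢x′ ∘ cong proj₁) e e′
        row+K≤R : ∀ x → eps-row A j x + K j ≤ R j
        row+K≤R x = sum-map-+-≤ allZ22-unique
          (λ y≢y′ → excess-A₃-exclusive ind j (y≢y′ ∘ cong proj₂))
          (λ y → excess+K≤R j (A₃-not-full ind j x y)
            (A₃-A₁-disjoint ind (shift≢-small j (s≤s z≤n) ≤-refl)))
          (K≤R j)

    eps₂+K≤R : ∀ j → eps₂ A (shift d j 2) + K j ≤ R j
    eps₂+K≤R j = sum-map-+-≤ allZ22-unique (excess-A₂-exclusive ind (shift d j 2))
      (λ x → excess+K≤R j (A₂-not-full ind (shift d j 2) x)
        (subst (λ i → DisjointDifferences (A₂ A (shift d j 2) x) (A₁ A i)) (shift-suc j 2)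
          (A₂-A₁-disjoint ind (shift≢-small (shift d j 2) (s≤s z≤n) (s≤s z≤n)))))
      (K≤R j)

  layer-bound : ∀ j →
    eps A j + eps₂ A (shift d j 2) + count (A₁ A (shift d j 3)) allZ22 ≤ 2 + chiA1 A (shift d j 3)
  layer-bound j with eps A j ≟ℕ 0 | eps₂ A (shift d j 2) ≟ℕ 0
  ... | yes eps≡0 | _ rewrite eps≡0 = eps₂+K≤R j
  ... | no _ | yes eps₂≡0 rewrite eps₂≡0 | +-identityʳ (eps A j) = eps+K≤R j
  ... | no eps≢0 | no eps₂≢0 =
    ⊥-elim (eps-eps₂-exclusive ind (shift≢-small j (s≤s z≤n) (s≤s (s≤s z≤n))) eps≢0 eps₂≢0)

lemma2 : (m : ℕ) → 4 ≤ m → (A : VSet m) → Independent m A →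
    sumZm m (λ i → eps A i) + sumZm m (λ i → sum (map (λ x → A2size A i x) allZ22))
      ≤ 2 * m + sumZm m (λ i → chiA1 A i)
lemma2 (suc n) (s≤s 3≤n) A ind = begin
  Σ (eps A) + Σ (λ i → sum (map (λ x → A2size A i x) allZ22))
    ≡⟨ cong (Σ (eps A) +_) (trans (sumZm-cong (sum-A2size A)) (sumZm-+ (eps₂ A) K)) ⟩
  Σ (eps A) + (Σ (eps₂ A) + Σ K)
    ≡⟨ +-assoc (Σ (eps A)) _ _ ⟨
  Σ (eps A) + Σ (eps₂ A) + Σ K
    ≡⟨ cong₂ (λ s k → Σ (eps A) + s + k) (sumZm-shift 2 (eps₂ A)) (sumZm-shift 3 K) ⟨
  Σ (eps A) + Σ (eps₂ A ∘ shift₂) + Σ (K ∘ shift₃)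
    ≡⟨ trans (sumZm-+ (λ j → eps A j + eps₂ A (shift₂ j)) (K ∘ shift₃))
             (cong (_+ Σ (K ∘ shift₃)) (sumZm-+ (eps A) (eps₂ A ∘ shift₂))) ⟨
  Σ (λ j → eps A j + eps₂ A (shift₂ j) + K (shift₃ j))
    ≤⟨ sumZm-mono (layer-bound 3≤n ind) ⟩
  Σ (λ j → 2 + chiA1 A (shift₃ j))
    ≡⟨ sumZm-+ (λ _ → 2) (chiA1 A ∘ shift₃) ⟩
  Σ (λ _ → 2) + Σ (chiA1 A ∘ shift₃)
    ≡⟨ cong₂ _+_ (sumZm-const d 2) (sumZm-shift 3 (chiA1 A)) ⟩
  2 * d + Σ (chiA1 A) ∎
  where
    open ≤-Reasoning
    d : ℕ
    d = suc n
    Σ : (Fin d → ℕ) → ℕ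
    Σ = sumZm d
    K : Fin d → ℕ
    K i = count (A₁ A i) allZ22
    shift₂ shift₃ : Fin d → Fin d
    shift₂ j = shift d j 2
    shift₃ j = shift d j 3
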